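{- Let $c>0$ be a sufficiently large constant, $p=c/k$, $\epsilon=c^{ -1/5}$, and let $G=G_k$ be a graph on $n$ vertices with minimum degree at least $k$. Run the DFS-algorithm on $G_p$, producing the rooted spanning forest $T$. Then a.a.s. (as $k\to\infty$) at most $4\epsilon^4 n$ vertices of $T$ are not free.
   Context: For a graph $G$ and $p\in[0,1]$, $G_p$ is obtained from $G$ by deleting each edge independently with probability $1-p$. The DFS-algorithm on $G_p$ (with $G$ known) maintains a partition of $V(G)$ into sets $R$ (fully explored), $S$ (a stack, vertices under exploration) and $U$ (unvisited), starting with $U=V(G)$, $R=S=\emptyset$. In each round: if $S=\emptyset$, some vertex of $U$ is moved to $S$ (root of a new tree); otherwise, for the top vertex $v$ of $S$, the algorithm queries, for neighbours $w\in U$ of $v$ in $G$, whether $vw\in E(G_p)$ (each query answered positively independently with probability $p$); upon a positive answer $w$ is pushed onto $S$, and if no such neighbour is found $v$ is moved to $R$. It stops when $R=V(G)$ and outputs a rooted spanning forest $T$ of $G_p$. An edge of $G$ is tested if the algorithm queried it and untested otherwise; $E_u$ is the set of untested edges of $G$. A vertex is free if it is incident with at least $(1-\epsilon)k$ edges of $E_u$. "A.a.s." means with probability tending to $1$ as $k\to\infty$.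
   Formalization: The sufficiently large constant c ranges over the rationals. -}

module Defs where

open import Data.Nat as ℕ using (ℕ; zero; suc; _∸_; _^_)
open import Data.Bool using (Bool; true; false; _∧_; _∨_; not; if_then_else_)
open import Data.Fin using (Fin)
open import Data.Fin.Properties using (_≟_)
open import Data.List using (List; []; _∷_; allFin; length; map; concatMap; foldr)
open import Data.Vec using (Vec; []; _∷_)
open import Data.Maybe using (Maybe; just; nothing)
open import Data.Product using (_×_; _,_)
open import Data.Integer using (+_)
open import Data.Rational as ℚ using (ℚ; 0ℚ; 1ℚ; _/_; _*_; _+_; _-_; _≤ᵇ_; _<_)
open import Relation.Nullary.Decidable using (⌊_⌋)
open import Relation.Binary.PropositionalEquality using (_≡_)

record Graph (n : ℕ) : Set where
  field
    adj    : Fin n → Fin n → Bool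
    sym    : ∀ i j → adj i j ≡ adj j i
    irrefl : ∀ i → adj i i ≡ false
open Graph public

countB : {A : Set} → (A → Bool) → List A → ℕ
countB p []       = 0
countB p (x ∷ xs) = if p x then suc (countB p xs) else countB p xs

anyB : {A : Set} → (A → Bool) → List A → Bool
anyB p []       = false
anyB p (x ∷ xs) = p x ∨ anyB p xs

firstB : {A : Set} → (A → Bool) → List A → Maybe A
firstB p []       = nothing
firstB p (x ∷ xs) = if p x then just x else firstB p xs

deg : ∀ {n} → Graph n → Fin n → ℕ
deg G v = countB (adj G v) (allFin _)

MinDeg≥ : ∀ {n} → Graph n → ℕ → Set
MinDeg≥ G k = ∀ v → k ℕ.≤ deg G v

_==_ : ∀ {n} → Fin n → Fin n → Bool
a == b = ⌊ a ≟ b ⌋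

_∈ᵇ_ : ∀ {n} → Fin n → List (Fin n) → Bool
v ∈ᵇ xs = anyB (λ w → v == w) xs

-- State: stack S (head = top), R (fully explored), tested edges,
-- history of query answers (most recent first).  U = V \ (S ∪ R).
record State (n : ℕ) : Set where
  field
    stack   : List (Fin n)
    done    : List (Fin n)
    tested  : List (Fin n × Fin n)
    history : List Bool
open State public

initState : ∀ {n} → State n
initState = record { stack = [] ; done = [] ; tested = [] ; history = [] }

inU : ∀ {n} → State n → Fin n → Bool
inU st v = not (v ∈ᵇ stack st) ∧ not (v ∈ᵇ done st)

testedᵇ : ∀ {n} → List (Fin n × Fin n) → Fin n → Fin n → Bool
testedᵇ ts v w = anyB (λ { (a , b) → ((a == v) ∧ (b == w)) ∨ ((a == w) ∧ (b == v)) }) ts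

-- A (deterministic, fully history-dependent) rule resolving the
-- choices left open by the algorithm: which vertex of U becomes a root,
-- and which neighbour w ∈ U of the top vertex is queried next.
-- Invalid proposals are replaced by the least valid vertex, so every
-- valid way of running the algorithm is represented.
record Strategy (n : ℕ) : Set where
  field
    chooseRoot : State n → Fin n
    chooseNbr  : State n → Fin n
open Strategy public

pick : ∀ {n} → (Fin n → Bool) → Fin n → Maybe (Fin n)
pick ok pref = if ok pref then just pref else firstB ok (allFin _)

-- answer to the t-th query, read off the coin vector
coinAt : ∀ {m} → Vec Bool m → ℕ → Bool
coinAt []       _       = false
coinAt (b ∷ bs) zero    = b
coinAt (b ∷ bs) (suc t) = coinAt bs t

step : ∀ {n m} → Graph n → Vec Bool m → Strategy n → State n → State n
step {n} G ω σ st = go (stack st)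
  where
  go : List (Fin n) → State n
  go [] with pick (inU st) (chooseRoot σ st)
  ... | nothing = st
  ... | just r  = record st { stack = r ∷ [] }
  go (v ∷ rest) with pick (λ w → adj G v w ∧ inU st w ∧ not (testedᵇ (tested st) v w))
                          (chooseNbr σ st)
  ... | nothing = record st { stack = rest ; done = v ∷ done st }
  ... | just w  = record st
          { tested  = (v , w) ∷ tested st
          ; history = b ∷ history st
          ; stack   = if b then w ∷ v ∷ rest else v ∷ rest }
    where b = coinAt ω (length (history st))

iterate : ∀ {A : Set} → ℕ → (A → A) → A → A
iterate zero    f a = a
iterate (suc t) f a = iterate t f (f a)

-- Run to completion: at most n + n + n*n rounds are needed (each round
-- moves a vertex U→S or S→R, or tests a new edge); once R = V the step
-- is the identity.
runDFS : ∀ {n m} → Graph n → Vec Bool m → Strategy n → State n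
runDFS {n} G ω σ = iterate (n ℕ.+ n ℕ.+ n ℕ.* n) (step G ω σ) initState

degU : ∀ {n} → Graph n → List (Fin n × Fin n) → Fin n → ℕ
degU G ts v = countB (λ w → adj G v w ∧ not (testedᵇ ts v w)) (allFin _)

ℕ→ℚ : ℕ → ℚ
ℕ→ℚ m = + m / 1

-- v is free iff degU v ≥ (1 - ε) k with ε = c^(-1/5); equivalently
-- c · (k ∸ degU v)^5 ≤ k^5.
freeᵇ : ∀ {n} → ℚ → ℕ → Graph n → List (Fin n × Fin n) → Fin n → Bool
freeᵇ c k G ts v = (c * ℕ→ℚ ((k ∸ degU G ts v) ^ 5)) ≤ᵇ ℕ→ℚ (k ^ 5)

nonFreeCount : ∀ {n} → ℚ → ℕ → Graph n → List (Fin n × Fin n) → ℕ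
nonFreeCount c k G ts = countB (λ v → not (freeᵇ c k G ts v)) (allFin _)

-- failure event: #non-free > 4 ε^4 n, i.e. c^4 · #nonfree^5 > 4^5 · n^5
failᵇ : ∀ {n} → ℚ → ℕ → Graph n → List (Fin n × Fin n) → Bool
failᵇ {n} c k G ts =
  not ((c * c * c * c * ℕ→ℚ (nonFreeCount c k G ts ^ 5)) ≤ᵇ ℕ→ℚ (1024 ℕ.* n ^ 5))

allVecs : ∀ m → List (Vec Bool m)
allVecs zero    = [] ∷ []
allVecs (suc m) = concatMap (λ v → (true ∷ v) ∷ (false ∷ v) ∷ []) (allVecs m)

weight : ∀ {m} → ℚ → Vec Bool m → ℚ
weight p []       = 1ℚ
weight p (b ∷ bs) = (if b then p else 1ℚ - p) * weight p bs

sumℚ : List ℚ → ℚ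
sumℚ = foldr _+_ 0ℚ

Pr : ∀ m → ℚ → (Vec Bool m → Bool) → ℚ
Pr m p E = sumℚ (map (λ ω → if E ω then weight p ω else 0ℚ) (allVecs m))

-- 1/k  (0 for k = 0)
inv : ℕ → ℚ
inv zero    = 0ℚ
inv (suc m) = + 1 / suc m

-- probability that, running DFS on G_p with p = c/k, more than 4ε^4 n
-- vertices are not free.  n*n coins suffice (≤ one query per pair).
failProb : ∀ {n} → ℚ → ℕ → Graph n → Strategy n → ℚ
failProb {n} c k G σ =
  Pr (n ℕ.* n) (c * inv k) (λ ω → failᵇ c k G (tested (runDFS G ω σ)))

module Submission where

-- Every positive answer pushes a vertex of U onto the stack, so at most n of the
-- queries are answered positively.  A vertex that is not free has more than ε k
-- tested edges (its degree is at least k), so F non-free vertices force more than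
-- F ε k / 2 queries; if F > 4 ε⁴ n, that is more than 2 n k / c = 2 n / p queries.
-- Among the first 2 n / p queries the number of positive answers is binomial with
-- mean above 2 n, and by Chebyshev it is at most n only with probability O(1 / n),
-- which is O(1 / k) since n ≥ k.  No lower bound on c is needed.  In integers, ε k
-- becomes the least t with c t⁵ > k⁵, and 2 n / p the least t with c t > 2 n k.

open import Data.Bool using (Bool; true; false; T; not; _∧_; _∨_; if_then_else_)
import Data.Bool.Properties as Boolₚ
open import Data.Empty using (⊥-elim)
open import Data.Fin as Fin using (Fin)
import Data.Fin.Properties as Finₚ
open import Data.Integer as ℤ using (-[1+_])
import Data.Integer.Properties as ℤₚ
open import Data.List using (List; []; _∷_; map; concatMap; length; tabulate; allFin)
open import Data.List.Membership.Propositional using (_∈_)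
open import Data.List.Membership.Propositional.Properties using (∈-allFin)
open import Data.List.Properties using (length-tabulate)
open import Data.List.Relation.Unary.Any using (here; there)
open import Data.Maybe using (just; nothing)
import Data.Nat
open import Data.Nat as ℕ using (ℕ; zero; suc; z≤n; s≤s)
import Data.Nat.Coprimality as Coprime
open import Data.Nat.ListAction using (sum)
import Data.Nat.Properties as ℕₚ
open import Algebra.Properties.CommutativeSemigroup ℕₚ.+-commutativeSemigroup using (interchange)
open import Data.Product using (Σ; _,_; _×_; proj₁; proj₂)
open import Data.Rational
  using (ℚ; mkℚ; *≤*; 0ℚ; 1ℚ; _+_; _*_; _-_; -_; 1/_; _≤_; _<_; _≤ᵇ_; NonZero; >-nonZero; positive; nonNegative)
import Data.Rational.Properties as ℚₚ
open import Data.Rational.Solver using (module +-*-Solver)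
open import Data.Sum using (inj₁; inj₂)
open import Data.Vec using (Vec; []; _∷_)
open import Function.Bundles using (Equivalence)
open import Relation.Binary.PropositionalEquality
open import Relation.Nullary using (Dec; yes; no; ¬_; _×-dec_)
open import Relation.Nullary.Decidable using (toWitness; fromWitness)

open import Defs hiding (sym)

open +-*-Solver

T-not : ∀ {x} → ¬ T x → T (not x)
T-not {true}  ¬x = ¬x _
T-not {false} _  = _

T-not⁻ : ∀ {x} → T (not x) → ¬ T x
T-not⁻ {true} () _

T-not-contra : ∀ {x y} → (T y → T x) → T (not x) → T (not y)
T-not-contra y⇒x ¬x = T-not (λ y → T-not⁻ ¬x (y⇒x y))

ℕ→ℚ≡mkℚ : ∀ m → ℕ→ℚ m ≡ mkℚ (ℤ.+ m) 0 (Coprime.sym (Coprime.1-coprimeTo m))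
ℕ→ℚ≡mkℚ m = ℚₚ.normalize-coprime (Coprime.sym (Coprime.1-coprimeTo m))

ℕ→ℚ-suc : ∀ m → ℕ→ℚ (suc m) ≡ 1ℚ + ℕ→ℚ m
ℕ→ℚ-suc m = trans (ℚₚ./-cong {ℤ.+ suc m} {1} numerator refl) (cong (1ℚ +_) (sym (ℕ→ℚ≡mkℚ m)))
  where
  numerator : ℤ.+ suc m ≡ ℤ.1ℤ ℤ.* ℤ.1ℤ ℤ.+ ℤ.+ m ℤ.* ℤ.1ℤ
  numerator = cong (ℤ._+_ ℤ.1ℤ) (sym (ℤₚ.*-identityʳ (ℤ.+ m)))

ℕ→ℚ-+ : ∀ a b → ℕ→ℚ (a ℕ.+ b) ≡ ℕ→ℚ a + ℕ→ℚ b
ℕ→ℚ-+ zero    b = sym (ℚₚ.+-identityˡ (ℕ→ℚ b))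
ℕ→ℚ-+ (suc a) b = begin
  ℕ→ℚ (suc (a ℕ.+ b))     ≡⟨ ℕ→ℚ-suc (a ℕ.+ b) ⟩
  1ℚ + ℕ→ℚ (a ℕ.+ b)      ≡⟨ cong (1ℚ +_) (ℕ→ℚ-+ a b) ⟩
  1ℚ + (ℕ→ℚ a + ℕ→ℚ b)    ≡⟨ ℚₚ.+-assoc 1ℚ (ℕ→ℚ a) (ℕ→ℚ b) ⟨
  (1ℚ + ℕ→ℚ a) + ℕ→ℚ b    ≡⟨ cong (_+ ℕ→ℚ b) (ℕ→ℚ-suc a) ⟨
  ℕ→ℚ (suc a) + ℕ→ℚ b     ∎
  where open ≡-Reasoning

ℕ→ℚ-* : ∀ a b → ℕ→ℚ (a ℕ.* b) ≡ ℕ→ℚ a * ℕ→ℚ b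
ℕ→ℚ-* zero    b = sym (ℚₚ.*-zeroˡ (ℕ→ℚ b))
ℕ→ℚ-* (suc a) b = begin
  ℕ→ℚ (b ℕ.+ a ℕ.* b)          ≡⟨ ℕ→ℚ-+ b (a ℕ.* b) ⟩
  ℕ→ℚ b + ℕ→ℚ (a ℕ.* b)        ≡⟨ cong (ℕ→ℚ b +_) (ℕ→ℚ-* a b) ⟩
  ℕ→ℚ b + ℕ→ℚ a * ℕ→ℚ b        ≡⟨ solve 2 (λ A B → B :+ A :* B := (con 1ℚ :+ A) :* B) refl (ℕ→ℚ a) (ℕ→ℚ b) ⟩
  (1ℚ + ℕ→ℚ a) * ℕ→ℚ b         ≡⟨ cong (_* ℕ→ℚ b) (ℕ→ℚ-suc a) ⟨
  ℕ→ℚ (suc a) * ℕ→ℚ b          ∎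
  where open ≡-Reasoning

ℕ→ℚ-nonNeg : ∀ m → 0ℚ ≤ ℕ→ℚ m
ℕ→ℚ-nonNeg m rewrite ℕ→ℚ≡mkℚ m = ℚₚ.nonNegative⁻¹ _

ℕ→ℚ-mono-≤ : ∀ {a b} → a ℕ.≤ b → ℕ→ℚ a ≤ ℕ→ℚ b
ℕ→ℚ-mono-≤ {a} {b} a≤b = begin
  ℕ→ℚ a                      ≡⟨ ℚₚ.+-identityʳ (ℕ→ℚ a) ⟨
  ℕ→ℚ a + 0ℚ                 ≤⟨ ℚₚ.+-monoʳ-≤ (ℕ→ℚ a) (ℕ→ℚ-nonNeg (b ℕ.∸ a)) ⟩
  ℕ→ℚ a + ℕ→ℚ (b ℕ.∸ a)      ≡⟨ ℕ→ℚ-+ a (b ℕ.∸ a) ⟨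
  ℕ→ℚ (a ℕ.+ (b ℕ.∸ a))      ≡⟨ cong ℕ→ℚ (ℕₚ.m+[n∸m]≡n a≤b) ⟩
  ℕ→ℚ b                      ∎
  where open ℚₚ.≤-Reasoning

ℕ→ℚ-unbounded : ∀ q → Σ ℕ λ N → q ≤ ℕ→ℚ N
ℕ→ℚ-unbounded q@(mkℚ (ℤ.+ a) _ _) = a , subst (q ≤_) (sym (ℕ→ℚ≡mkℚ a))
  (*≤* (ℤₚ.*-monoˡ-≤-nonNeg (ℤ.+ a) (ℤ.+≤+ (s≤s z≤n))))
ℕ→ℚ-unbounded (mkℚ -[1+ _ ] _ _) = 0 , ℚₚ.nonPositive⁻¹ _

inv-*-ℕ→ℚ : ∀ k → inv (suc k) * ℕ→ℚ (suc k) ≡ 1ℚ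
inv-*-ℕ→ℚ k rewrite ℕ→ℚ≡mkℚ (suc k) | ℚₚ.normalize-coprime {1} {k} (Coprime.1-coprimeTo (suc k)) =
  ℚₚ.*-inverseˡ (mkℚ (ℤ.+ suc k) 0 (Coprime.sym (Coprime.1-coprimeTo (suc k))))

inv-nonNeg : ∀ k → 0ℚ ≤ inv k
inv-nonNeg zero    = ℚₚ.≤-refl
inv-nonNeg (suc k) rewrite ℚₚ.normalize-coprime {1} {k} (Coprime.1-coprimeTo (suc k)) = ℚₚ.nonNegative⁻¹ _

inv-pos : ∀ k → 0ℚ < inv (suc k)
inv-pos k rewrite ℚₚ.normalize-coprime {1} {k} (Coprime.1-coprimeTo (suc k)) = ℚₚ.positive⁻¹ _

*-nonNeg : ∀ {p q} → 0ℚ ≤ p → 0ℚ ≤ q → 0ℚ ≤ p * q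
*-nonNeg {p} {q} 0≤p 0≤q =
  ℚₚ.nonNegative⁻¹ (p * q) {{ℚₚ.nonNeg*nonNeg⇒nonNeg p {{nonNegative 0≤p}} q {{nonNegative 0≤q}}}}

*-monoˡ-≤ : ∀ {r p q} → 0ℚ ≤ r → p ≤ q → r * p ≤ r * q
*-monoˡ-≤ {r} 0≤r = ℚₚ.*-monoˡ-≤-nonNeg r {{nonNegative 0≤r}}

*-monoʳ-≤ : ∀ {r p q} → 0ℚ ≤ r → p ≤ q → p * r ≤ q * r
*-monoʳ-≤ {r} 0≤r = ℚₚ.*-monoʳ-≤-nonNeg r {{nonNegative 0≤r}}

*-mono-≤ : ∀ {p q r s} → 0ℚ ≤ p → 0ℚ ≤ r → p ≤ q → r ≤ s → p * r ≤ q * s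
*-mono-≤ 0≤p 0≤r p≤q r≤s = ℚₚ.≤-trans (*-monoˡ-≤ 0≤p r≤s) (*-monoʳ-≤ (ℚₚ.≤-trans 0≤r r≤s) p≤q)

*-mono-< : ∀ {p q r s} → 0ℚ ≤ p → 0ℚ ≤ r → p < q → r < s → p * r < q * s
*-mono-< {p} {q} {r} {s} 0≤p 0≤r p<q r<s = ℚₚ.≤-<-trans (*-monoˡ-≤ 0≤p (ℚₚ.<⇒≤ r<s))
  (ℚₚ.*-monoˡ-<-pos s {{positive (ℚₚ.≤-<-trans 0≤r r<s)}} p<q)

≤⇒0≤- : ∀ {p q} → p ≤ q → 0ℚ ≤ q - p
≤⇒0≤- {p} {q} p≤q = subst (_≤ q - p) (ℚₚ.+-inverseʳ p) (ℚₚ.+-monoˡ-≤ (- p) p≤q)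

<⇒0<- : ∀ {p q} → p < q → 0ℚ < q - p
<⇒0<- {p} {q} p<q = subst (_< q - p) (ℚₚ.+-inverseʳ p) (ℚₚ.+-monoˡ-< (- p) p<q)

0≤-⇒≤ : ∀ {p q} → 0ℚ ≤ q - p → p ≤ q
0≤-⇒≤ {p} {q} h = subst₂ _≤_ (ℚₚ.+-identityˡ p) (solve 2 (λ p q → (q :- p) :+ p := q) refl p q)
  (ℚₚ.+-monoˡ-≤ p h)

0<-⇒< : ∀ {p q} → 0ℚ < q - p → p < q
0<-⇒< {p} {q} h = subst₂ _<_ (ℚₚ.+-identityˡ p) (solve 2 (λ p q → (q :- p) :+ p := q) refl p q)
  (ℚₚ.+-monoˡ-< p h)

halve-< : ∀ {p q} → p + p < q + q → p < q
halve-< {p} {q} 2p<2q with p ℚₚ.<? q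
... | yes p<q = p<q
... | no  p≮q = ⊥-elim (ℚₚ.<-irrefl refl
                  (ℚₚ.<-≤-trans 2p<2q (ℚₚ.+-mono-≤ (ℚₚ.≮⇒≥ p≮q) (ℚₚ.≮⇒≥ p≮q))))

T-not-≤ᵇ : ∀ {p q} → T (not (p ≤ᵇ q)) → q < p
T-not-≤ᵇ p≰q = ℚₚ.≰⇒> (λ p≤q → T-not⁻ p≰q (ℚₚ.≤⇒≤ᵇ p≤q))

infixr 8 _^_
_^_ : ℚ → ℕ → ℚ
p ^ zero  = 1ℚ
p ^ suc n = p * p ^ n

ℕ→ℚ-^ : ∀ a n → ℕ→ℚ (a ℕ.^ n) ≡ ℕ→ℚ a ^ n
ℕ→ℚ-^ a zero    = refl
ℕ→ℚ-^ a (suc n) = trans (ℕ→ℚ-* a (a ℕ.^ n)) (cong (ℕ→ℚ a *_) (ℕ→ℚ-^ a n))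

*-^ : ∀ p q n → (p * q) ^ n ≡ p ^ n * q ^ n
*-^ p q zero    = refl
*-^ p q (suc n) = trans (cong (p * q *_) (*-^ p q n))
  (solve 4 (λ p q x y → p :* q :* (x :* y) := p :* x :* (q :* y)) refl p q (p ^ n) (q ^ n))

^-nonNeg : ∀ n {p} → 0ℚ ≤ p → 0ℚ ≤ p ^ n
^-nonNeg zero    0≤p = ℚₚ.nonNegative⁻¹ 1ℚ
^-nonNeg (suc n) 0≤p = *-nonNeg 0≤p (^-nonNeg n 0≤p)

^-monoˡ-≤ : ∀ n {p q} → 0ℚ ≤ p → p ≤ q → p ^ n ≤ q ^ n
^-monoˡ-≤ zero    0≤p p≤q = ℚₚ.≤-refl
^-monoˡ-≤ (suc n) 0≤p p≤q = *-mono-≤ 0≤p (^-nonNeg n 0≤p) p≤q (^-monoˡ-≤ n 0≤p p≤q)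

^-cancelˡ-< : ∀ n {p q} → 0ℚ ≤ q → p ^ n < q ^ n → p < q
^-cancelˡ-< n {p} {q} 0≤q pⁿ<qⁿ with p ℚₚ.<? q
... | yes p<q = p<q
... | no  p≮q = ⊥-elim (ℚₚ.<-irrefl refl
                  (ℚₚ.<-≤-trans pⁿ<qⁿ (^-monoˡ-≤ n 0≤q (ℚₚ.≮⇒≥ p≮q))))

fifthRoot-*-< : ∀ {c x y a b} → 0ℚ ≤ c → 0ℚ ≤ x → 0ℚ ≤ y → 0ℚ ≤ a → 0ℚ ≤ b →
                x ^ 5 < c * c * c * c * y ^ 5 → a ^ 5 < c * b ^ 5 → x * a < c * (y * b)
fifthRoot-*-< {c} {x} {y} {a} {b} 0≤c 0≤x 0≤y 0≤a 0≤b x⁵<c⁴y⁵ a⁵<cb⁵ =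
  ^-cancelˡ-< 5 (*-nonNeg 0≤c (*-nonNeg 0≤y 0≤b)) (begin-strict
    (x * a) ^ 5                               ≡⟨ *-^ x a 5 ⟩
    x ^ 5 * a ^ 5                             <⟨ *-mono-< (^-nonNeg 5 0≤x) (^-nonNeg 5 0≤a) x⁵<c⁴y⁵ a⁵<cb⁵ ⟩
    (c * c * c * c * y ^ 5) * (c * b ^ 5)     ≡⟨ solve 3 (λ c Y B → (c :* c :* c :* c :* Y) :* (c :* B)
                                                   := c :* (c :* (c :* (c :* (c :* con 1ℚ)))) :* (Y :* B))
                                                   refl c (y ^ 5) (b ^ 5) ⟩
    c ^ 5 * (y ^ 5 * b ^ 5)                   ≡⟨ cong (c ^ 5 *_) (*-^ y b 5) ⟨
    c ^ 5 * (y * b) ^ 5                       ≡⟨ *-^ c (y * b) 5 ⟨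
    (c * (y * b)) ^ 5                         ∎)
  where open ℚₚ.≤-Reasoning

2/δ≤N⇒2≤δN : ∀ {δ N} .{{_ : NonZero δ}} → 0ℚ ≤ δ → (1ℚ + 1ℚ) * 1/ δ ≤ ℕ→ℚ N → 1ℚ + 1ℚ ≤ δ * ℕ→ℚ N
2/δ≤N⇒2≤δN {δ} {N} 0≤δ 2/δ≤N = begin
  1ℚ + 1ℚ                 ≡⟨ ℚₚ.*-identityˡ (1ℚ + 1ℚ) ⟨
  1ℚ * (1ℚ + 1ℚ)          ≡⟨ cong (_* (1ℚ + 1ℚ)) (ℚₚ.*-inverseʳ δ) ⟨
  δ * 1/ δ * (1ℚ + 1ℚ)    ≡⟨ solve 2 (λ δ i → δ :* i :* (con 1ℚ :+ con 1ℚ) := δ :* ((con 1ℚ :+ con 1ℚ) :* i))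
                                refl δ (1/ δ) ⟩
  δ * ((1ℚ + 1ℚ) * 1/ δ)  ≤⟨ *-monoˡ-≤ 0≤δ 2/δ≤N ⟩
  δ * ℕ→ℚ N               ∎
  where open ℚₚ.≤-Reasoning

-- Finite probability over coin vectors

module _ {A : Set} where

  sumℚ-map-cong : ∀ {f g : A → ℚ} xs → (∀ x → f x ≡ g x) → sumℚ (map f xs) ≡ sumℚ (map g xs)
  sumℚ-map-cong []       f≡g = refl
  sumℚ-map-cong (x ∷ xs) f≡g = cong₂ _+_ (f≡g x) (sumℚ-map-cong xs f≡g)

  sumℚ-map-mono : ∀ {f g : A → ℚ} xs → (∀ x → f x ≤ g x) → sumℚ (map f xs) ≤ sumℚ (map g xs)
  sumℚ-map-mono []       f≤g = ℚₚ.≤-refl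
  sumℚ-map-mono (x ∷ xs) f≤g = ℚₚ.+-mono-≤ (f≤g x) (sumℚ-map-mono xs f≤g)

  sumℚ-map-0 : ∀ (xs : List A) → sumℚ (map (λ _ → 0ℚ) xs) ≡ 0ℚ
  sumℚ-map-0 []       = refl
  sumℚ-map-0 (x ∷ xs) = cong (0ℚ +_) (sumℚ-map-0 xs)

  sumℚ-map-*ʳ : ∀ r (f : A → ℚ) xs → sumℚ (map (λ x → f x * r) xs) ≡ sumℚ (map f xs) * r
  sumℚ-map-*ʳ r f []       = sym (ℚₚ.*-zeroˡ r)
  sumℚ-map-*ʳ r f (x ∷ xs) = trans (cong (f x * r +_) (sumℚ-map-*ʳ r f xs))
    (sym (ℚₚ.*-distribʳ-+ r (f x) (sumℚ (map f xs))))

  sumℚ-map-linear : ∀ a b (f g : A → ℚ) xs →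
    sumℚ (map (λ x → a * f x + b * g x) xs) ≡ a * sumℚ (map f xs) + b * sumℚ (map g xs)
  sumℚ-map-linear a b f g []       = solve 2 (λ a b → con 0ℚ := a :* con 0ℚ :+ b :* con 0ℚ) refl a b
  sumℚ-map-linear a b f g (x ∷ xs) = trans (cong (a * f x + b * g x +_) (sumℚ-map-linear a b f g xs))
    (solve 6 (λ a b F G S T → (a :* F :+ b :* G) :+ (a :* S :+ b :* T) := a :* (F :+ S) :+ b :* (G :+ T))
      refl a b (f x) (g x) (sumℚ (map f xs)) (sumℚ (map g xs)))

sumℚ-allVecs-suc : ∀ {m} (f : Vec Bool (suc m) → ℚ) →
  sumℚ (map f (allVecs (suc m))) ≡ sumℚ (map (λ ω → f (true ∷ ω) + f (false ∷ ω)) (allVecs m))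
sumℚ-allVecs-suc {m} f = go (allVecs m)
  where
  go : ∀ ωs → sumℚ (map f (concatMap (λ ω → (true ∷ ω) ∷ (false ∷ ω) ∷ []) ωs))
              ≡ sumℚ (map (λ ω → f (true ∷ ω) + f (false ∷ ω)) ωs)
  go []       = refl
  go (ω ∷ ωs) = trans (cong (λ s → f (true ∷ ω) + (f (false ∷ ω) + s)) (go ωs))
    (sym (ℚₚ.+-assoc (f (true ∷ ω)) (f (false ∷ ω)) _))

weight-nonNeg : ∀ {m p} → 0ℚ ≤ p → p ≤ 1ℚ → (ω : Vec Bool m) → 0ℚ ≤ weight p ω
weight-nonNeg 0≤p p≤1 []          = ℚₚ.nonNegative⁻¹ 1ℚ
weight-nonNeg 0≤p p≤1 (true ∷ ω)  = *-nonNeg 0≤p (weight-nonNeg 0≤p p≤1 ω)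
weight-nonNeg 0≤p p≤1 (false ∷ ω) = *-nonNeg (≤⇒0≤- p≤1) (weight-nonNeg 0≤p p≤1 ω)

expect : ∀ m → ℚ → (Vec Bool m → ℚ) → ℚ
expect m p f = sumℚ (map (λ ω → weight p ω * f ω) (allVecs m))

expect-cong : ∀ m p {f g} → (∀ ω → f ω ≡ g ω) → expect m p f ≡ expect m p g
expect-cong m p f≡g = sumℚ-map-cong (allVecs m) (λ ω → cong (weight p ω *_) (f≡g ω))

expect-linear : ∀ m p a b f g →
  expect m p (λ ω → a * f ω + b * g ω) ≡ a * expect m p f + b * expect m p g
expect-linear m p a b f g = trans
  (sumℚ-map-cong (allVecs m) λ ω →
    solve 5 (λ w a b F G → w :* (a :* F :+ b :* G) := a :* (w :* F) :+ b :* (w :* G))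
      refl (weight p ω) a b (f ω) (g ω))
  (sumℚ-map-linear a b _ _ (allVecs m))

expect-suc : ∀ m p f →
  expect (suc m) p f ≡ expect m p (λ ω → p * f (true ∷ ω) + (1ℚ - p) * f (false ∷ ω))
expect-suc m p f = trans (sumℚ-allVecs-suc (λ ω → weight p ω * f ω))
  (sumℚ-map-cong (allVecs m) λ ω →
    solve 4 (λ p w A B → p :* w :* A :+ (con 1ℚ :- p) :* w :* B := w :* (p :* A :+ (con 1ℚ :- p) :* B))
      refl p (weight p ω) (f (true ∷ ω)) (f (false ∷ ω)))

expect-const : ∀ m p a → expect m p (λ _ → a) ≡ a
expect-const zero    p a = solve 1 (λ a → con 1ℚ :* a :+ con 0ℚ := a) refl a
expect-const (suc m) p a = begin
  expect (suc m) p (λ _ → a)                ≡⟨ expect-suc m p (λ _ → a) ⟩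
  expect m p (λ _ → p * a + (1ℚ - p) * a)   ≡⟨ expect-cong m p (λ _ → mix≡a) ⟩
  expect m p (λ _ → a)                      ≡⟨ expect-const m p a ⟩
  a                                         ∎
  where
  open ≡-Reasoning
  mix≡a : p * a + (1ℚ - p) * a ≡ a
  mix≡a = solve 2 (λ p a → p :* a :+ (con 1ℚ :- p) :* a := a) refl p a

Pr-mono : ∀ m {p} (E E′ : Vec Bool m → Bool) → 0ℚ ≤ p → p ≤ 1ℚ →
          (∀ ω → T (E ω) → T (E′ ω)) → Pr m p E ≤ Pr m p E′
Pr-mono m {p} E E′ 0≤p p≤1 E⊆E′ = sumℚ-map-mono (allVecs m) pointwise
  where
  pointwise : ∀ ω → (if E ω then weight p ω else 0ℚ) ≤ (if E′ ω then weight p ω else 0ℚ)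
  pointwise ω with E ω | E′ ω | E⊆E′ ω
  ... | true  | true  | _   = ℚₚ.≤-refl
  ... | true  | false | E⇒ = ⊥-elim (E⇒ _)
  ... | false | true  | _   = weight-nonNeg 0≤p p≤1 ω
  ... | false | false | _   = ℚₚ.≤-refl

Pr-≡0 : ∀ m p (E : Vec Bool m → Bool) → (∀ ω → ¬ T (E ω)) → Pr m p E ≡ 0ℚ
Pr-≡0 m p E never = trans (sumℚ-map-cong (allVecs m) vanishes) (sumℚ-map-0 (allVecs m))
  where
  vanishes : ∀ ω → (if E ω then weight p ω else 0ℚ) ≡ 0ℚ
  vanishes ω with E ω | never ω
  ... | true  | ¬E = ⊥-elim (¬E _)
  ... | false | _  = refl

Pr-*-≤-expect : ∀ m {p r} (E : Vec Bool m → Bool) (g : Vec Bool m → ℚ) → 0ℚ ≤ p → p ≤ 1ℚ →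
                (∀ ω → 0ℚ ≤ g ω) → (∀ ω → T (E ω) → r ≤ g ω) → Pr m p E * r ≤ expect m p g
Pr-*-≤-expect m {p} {r} E g 0≤p p≤1 0≤g E⇒r≤g = begin
  Pr m p E * r                                                    ≡⟨ sumℚ-map-*ʳ r _ (allVecs m) ⟨
  sumℚ (map (λ ω → (if E ω then weight p ω else 0ℚ) * r) (allVecs m)) ≤⟨ sumℚ-map-mono (allVecs m) pointwise ⟩
  expect m p g                                                    ∎
  where
  open ℚₚ.≤-Reasoning
  pointwise : ∀ ω → (if E ω then weight p ω else 0ℚ) * r ≤ weight p ω * g ω
  pointwise ω with E ω | E⇒r≤g ω
  ... | true  | r≤g = *-monoˡ-≤ (weight-nonNeg 0≤p p≤1 ω) (r≤g _)
  ... | false | _   = subst (_≤ weight p ω * g ω) (sym (ℚₚ.*-zeroˡ r))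
                        (*-nonNeg (weight-nonNeg 0≤p p≤1 ω) (0≤g ω))

trueCount : ∀ {m} → ℕ → Vec Bool m → ℕ
trueCount zero    _       = 0
trueCount (suc t) []      = 0
trueCount (suc t) (b ∷ ω) = if b then suc (trueCount t ω) else trueCount t ω

trueCount-suc : ∀ {m} t (ω : Vec Bool m) →
  trueCount (suc t) ω ≡ (if coinAt ω t then suc (trueCount t ω) else trueCount t ω)
trueCount-suc zero    []      = refl
trueCount-suc (suc t) []      = refl
trueCount-suc zero    (b ∷ ω) = refl
trueCount-suc (suc t) (b ∷ ω) rewrite trueCount-suc t ω with b | coinAt ω t
... | true  | true  = refl
... | true  | false = refl
... | false | _     = refl

trueCount-mono : ∀ {m t t′} (ω : Vec Bool m) → t ℕ.≤ t′ → trueCount t ω ℕ.≤ trueCount t′ ω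
trueCount-mono {t = zero}              ω           _         = z≤n
trueCount-mono {t = suc t} {suc t′}    []          _         = z≤n
trueCount-mono {t = suc t} {suc t′}    (true ∷ ω)  (s≤s t≤t′) = s≤s (trueCount-mono ω t≤t′)
trueCount-mono {t = suc t} {suc t′}    (false ∷ ω) (s≤s t≤t′) = trueCount-mono ω t≤t′

infix 9 _²
_² : ℚ → ℚ
q ² = q * q

trueCount-secondMoment : ∀ m p t a → t ℕ.≤ m →
  expect m p (λ ω → (a - ℕ→ℚ (trueCount t ω)) ²) ≡ (a - ℕ→ℚ t * p) ² + ℕ→ℚ t * p * (1ℚ - p)
trueCount-secondMoment m p zero a _ = trans (expect-const m p _)
  (solve 2 (λ a p → (a :- con 0ℚ) :* (a :- con 0ℚ)
                    := (a :- con 0ℚ :* p) :* (a :- con 0ℚ :* p) :+ con 0ℚ :* p :* (con 1ℚ :- p)) refl a p)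
trueCount-secondMoment (suc m) p (suc t) a (s≤s t≤m) = begin
  expect (suc m) p (λ ω → (a - ℕ→ℚ (trueCount (suc t) ω)) ²)
    ≡⟨ expect-suc m p _ ⟩
  expect m p (λ ω → p * (a - ℕ→ℚ (suc (X ω))) ² + (1ℚ - p) * (a - ℕ→ℚ (X ω)) ²)
    ≡⟨ expect-cong m p (λ ω → cong (λ y → p * (a - y) ² + (1ℚ - p) * (a - ℕ→ℚ (X ω)) ²) (ℕ→ℚ-suc (X ω))) ⟩
  expect m p (λ ω → p * (a - (1ℚ + ℕ→ℚ (X ω))) ² + (1ℚ - p) * (a - ℕ→ℚ (X ω)) ²)
    ≡⟨ expect-cong m p (λ ω → cong (λ z → p * z + (1ℚ - p) * (a - ℕ→ℚ (X ω)) ²)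
         (solve 2 (λ a x → (a :- (con 1ℚ :+ x)) :* (a :- (con 1ℚ :+ x))
                           := (a :- con 1ℚ :- x) :* (a :- con 1ℚ :- x)) refl a (ℕ→ℚ (X ω)))) ⟩
  expect m p (λ ω → p * ((a - 1ℚ) - ℕ→ℚ (X ω)) ² + (1ℚ - p) * (a - ℕ→ℚ (X ω)) ²)
    ≡⟨ expect-linear m p p (1ℚ - p) _ _ ⟩
  p * expect m p (λ ω → ((a - 1ℚ) - ℕ→ℚ (X ω)) ²) + (1ℚ - p) * expect m p (λ ω → (a - ℕ→ℚ (X ω)) ²)
    ≡⟨ cong₂ (λ x y → p * x + (1ℚ - p) * y)
         (trueCount-secondMoment m p t (a - 1ℚ) t≤m) (trueCount-secondMoment m p t a t≤m) ⟩
  p * ((a - 1ℚ - s * p) ² + s * p * (1ℚ - p)) + (1ℚ - p) * ((a - s * p) ² + s * p * (1ℚ - p))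
    ≡⟨ solve 3 (λ a s p →
         p :* ((a :- con 1ℚ :- s :* p) :* (a :- con 1ℚ :- s :* p) :+ s :* p :* (con 1ℚ :- p))
           :+ (con 1ℚ :- p) :* ((a :- s :* p) :* (a :- s :* p) :+ s :* p :* (con 1ℚ :- p))
         := (a :- (con 1ℚ :+ s) :* p) :* (a :- (con 1ℚ :+ s) :* p) :+ (con 1ℚ :+ s) :* p :* (con 1ℚ :- p))
         refl a s p ⟩
  (a - (1ℚ + s) * p) ² + (1ℚ + s) * p * (1ℚ - p)
    ≡⟨ cong (λ z → (a - z * p) ² + z * p * (1ℚ - p)) (ℕ→ℚ-suc t) ⟨
  (a - ℕ→ℚ (suc t) * p) ² + ℕ→ℚ (suc t) * p * (1ℚ - p) ∎
  where
  open ≡-Reasoning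
  X : Vec Bool m → ℕ
  X = trueCount t
  s : ℚ
  s = ℕ→ℚ t

Pr[trueCount≤]*²≤ : ∀ m {p} t x → 0ℚ ≤ p → p ≤ 1ℚ → t ℕ.≤ m → ℕ→ℚ x ≤ ℕ→ℚ t * p →
  Pr m p (λ ω → trueCount t ω ℕ.≤ᵇ x) * (ℕ→ℚ t * p - ℕ→ℚ x) ² ≤ ℕ→ℚ t * p
Pr[trueCount≤]*²≤ m {p} t x 0≤p p≤1 t≤m x≤tp = begin
  Pr m p (λ ω → trueCount t ω ℕ.≤ᵇ x) * (tp - ℕ→ℚ x) ²
    ≤⟨ Pr-*-≤-expect m _ _ 0≤p p≤1 (λ ω → square-nonNeg (tp - ℕ→ℚ (trueCount t ω))) deviation ⟩
  expect m p (λ ω → (tp - ℕ→ℚ (trueCount t ω)) ²)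
    ≡⟨ trueCount-secondMoment m p t tp t≤m ⟩
  (tp - tp) ² + tp * (1ℚ - p)
    ≤⟨ 0≤-⇒≤ (subst (0ℚ ≤_) (solve 2 (λ tp p → tp :* p := tp :- ((tp :- tp) :* (tp :- tp) :+ tp :* (con 1ℚ :- p)))
                                       refl tp p)
                             (*-nonNeg 0≤tp 0≤p)) ⟩
  tp ∎
  where
  open ℚₚ.≤-Reasoning
  tp : ℚ
  tp = ℕ→ℚ t * p
  0≤tp : 0ℚ ≤ tp
  0≤tp = *-nonNeg (ℕ→ℚ-nonNeg t) 0≤p
  square-nonNeg : ∀ q → 0ℚ ≤ q ²
  square-nonNeg q with ℚₚ.≤-total 0ℚ q
  ... | inj₁ 0≤q = *-nonNeg 0≤q 0≤q
  ... | inj₂ q≤0 = subst (0ℚ ≤_) (solve 1 (λ q → (:- q) :* (:- q) := q :* q) refl q)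
                     (*-nonNeg (ℚₚ.neg-antimono-≤ q≤0) (ℚₚ.neg-antimono-≤ q≤0))
  deviation : ∀ ω → T (trueCount t ω ℕ.≤ᵇ x) → (tp - ℕ→ℚ x) ² ≤ (tp - ℕ→ℚ (trueCount t ω)) ²
  deviation ω X≤x = *-mono-≤ (≤⇒0≤- x≤tp) (≤⇒0≤- x≤tp) tp-x≤tp-X tp-x≤tp-X
    where
    tp-x≤tp-X : tp - ℕ→ℚ x ≤ tp - ℕ→ℚ (trueCount t ω)
    tp-x≤tp-X = ℚₚ.+-monoʳ-≤ tp (ℚₚ.neg-antimono-≤ (ℕ→ℚ-mono-≤ (ℕₚ.≤ᵇ⇒≤ (trueCount t ω) x X≤x)))

-- If 2 x < t p then t p / (t p - x)² < 2 / (t p - x) < 2 / x.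
Pr[trueCount≤]≤ : ∀ m {p δ} t x → 0ℚ ≤ p → p ≤ 1ℚ → t ℕ.≤ m → 0ℚ ≤ δ →
  ℕ→ℚ x + ℕ→ℚ x < ℕ→ℚ t * p → 1ℚ + 1ℚ ≤ δ * ℕ→ℚ x →
  Pr m p (λ ω → trueCount t ω ℕ.≤ᵇ x) ≤ δ
Pr[trueCount≤]≤ m {p} {δ} t x 0≤p p≤1 t≤m 0≤δ 2x<tp 2≤δx =
  ℚₚ.*-cancelʳ-≤-pos (D ²) {{ℚₚ.pos*pos⇒pos D {{positive 0<D}} D {{positive 0<D}}}} (begin
    Pr m p _ * D ²      ≤⟨ Pr[trueCount≤]*²≤ m t x 0≤p p≤1 t≤m (ℚₚ.<⇒≤ x<tp) ⟩
    tp                  ≡⟨ solve 2 (λ tp x → tp := (tp :- x) :+ x) refl tp (ℕ→ℚ x) ⟩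
    D + ℕ→ℚ x           ≤⟨ ℚₚ.+-monoʳ-≤ D (ℚₚ.<⇒≤ x<D) ⟩
    D + D               ≡⟨ solve 1 (λ D → D :+ D := D :* (con 1ℚ :+ con 1ℚ)) refl D ⟩
    D * (1ℚ + 1ℚ)       ≤⟨ *-monoˡ-≤ (ℚₚ.<⇒≤ 0<D) 2≤δx ⟩
    D * (δ * ℕ→ℚ x)     ≤⟨ *-monoˡ-≤ (ℚₚ.<⇒≤ 0<D) (*-monoˡ-≤ 0≤δ (ℚₚ.<⇒≤ x<D)) ⟩
    D * (δ * D)         ≡⟨ solve 2 (λ D δ → D :* (δ :* D) := δ :* (D :* D)) refl D δ ⟩
    δ * D ²             ∎)
  where
  open ℚₚ.≤-Reasoning
  tp : ℚ
  tp = ℕ→ℚ t * p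
  D : ℚ
  D = tp - ℕ→ℚ x
  x<D : ℕ→ℚ x < D
  x<D = 0<-⇒< (subst (0ℚ <_) (solve 2 (λ tp x → tp :- (x :+ x) := (tp :- x) :- x) refl tp (ℕ→ℚ x)) (<⇒0<- 2x<tp))
  0<D : 0ℚ < D
  0<D = ℚₚ.≤-<-trans (ℕ→ℚ-nonNeg x) x<D
  x<tp : ℕ→ℚ x < tp
  x<tp = ℚₚ.≤-<-trans (subst (_≤ ℕ→ℚ x + ℕ→ℚ x) (ℚₚ.+-identityʳ (ℕ→ℚ x))
                         (ℚₚ.+-monoʳ-≤ (ℕ→ℚ x) (ℕ→ℚ-nonNeg x))) 2x<tp

-- Counting

module _ {A : Set} where

  countB-mono : ∀ {p q : A → Bool} xs → (∀ x → T (p x) → T (q x)) → countB p xs ℕ.≤ countB q xs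
  countB-mono {p} {q} []       p⇒q = z≤n
  countB-mono {p} {q} (x ∷ xs) p⇒q with p x | q x | p⇒q x
  ... | true  | true  | _   = s≤s (countB-mono xs p⇒q)
  ... | true  | false | p⇒q = ⊥-elim (p⇒q _)
  ... | false | true  | _   = ℕₚ.m≤n⇒m≤1+n (countB-mono xs p⇒q)
  ... | false | false | _   = countB-mono xs p⇒q

  countB-mono-< : ∀ {p q : A → Bool} xs → (∀ x → T (p x) → T (q x)) →
                  ∀ {y} → y ∈ xs → ¬ T (p y) → T (q y) → countB p xs ℕ.< countB q xs
  countB-mono-< {p} {q} (x ∷ xs) p⇒q (here refl) ¬py qy with p x | q x
  ... | false | true = s≤s (countB-mono xs p⇒q)
  ... | true  | _    = ⊥-elim (¬py _)
  countB-mono-< {p} {q} (x ∷ xs) p⇒q (there y∈xs) ¬py qy with p x | q x | p⇒q x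
  ... | true  | true  | _   = s≤s (countB-mono-< xs p⇒q y∈xs ¬py qy)
  ... | true  | false | p⇒q = ⊥-elim (p⇒q _)
  ... | false | true  | _   = ℕₚ.m≤n⇒m≤1+n (countB-mono-< xs p⇒q y∈xs ¬py qy)
  ... | false | false | _   = countB-mono-< xs p⇒q y∈xs ¬py qy

  countB-≤-length : ∀ (p : A → Bool) xs → countB p xs ℕ.≤ length xs
  countB-≤-length p []       = z≤n
  countB-≤-length p (x ∷ xs) with p x
  ... | true  = s≤s (countB-≤-length p xs)
  ... | false = ℕₚ.m≤n⇒m≤1+n (countB-≤-length p xs)

  countB-witness : ∀ {p : A → Bool} xs → 0 ℕ.< countB p xs → Σ A λ x → T (p x)
  countB-witness {p} (x ∷ xs) 0<count with p x in px
  ... | true  = x , subst T (sym px) _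
  ... | false = countB-witness xs 0<count

  countB-∨ : ∀ (p q : A → Bool) xs → countB (λ x → p x ∨ q x) xs ℕ.≤ countB p xs ℕ.+ countB q xs
  countB-∨ p q []       = z≤n
  countB-∨ p q (x ∷ xs) with p x | q x
  ... | true  | true  = s≤s (ℕₚ.≤-trans (countB-∨ p q xs) (ℕₚ.+-monoʳ-≤ (countB p xs) (ℕₚ.n≤1+n _)))
  ... | true  | false = s≤s (countB-∨ p q xs)
  ... | false | true  = subst (suc (countB (λ y → p y ∨ q y) xs) ℕ.≤_) (sym (ℕₚ.+-suc (countB p xs) (countB q xs)))
                          (s≤s (countB-∨ p q xs))
  ... | false | false = countB-∨ p q xs

  countB-*-≤-sum : ∀ {p : A → Bool} {f : A → ℕ} {b} xs → (∀ x → T (p x) → b ℕ.≤ f x) →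
                   countB p xs ℕ.* b ℕ.≤ sum (map f xs)
  countB-*-≤-sum {p} []       p⇒b≤f = z≤n
  countB-*-≤-sum {p} (x ∷ xs) p⇒b≤f with p x | p⇒b≤f x
  ... | true  | b≤f = ℕₚ.+-mono-≤ (b≤f _) (countB-*-≤-sum xs p⇒b≤f)
  ... | false | _   = ℕₚ.≤-trans (countB-*-≤-sum xs p⇒b≤f) (ℕₚ.m≤n+m _ _)

  sum-map-mono : ∀ {f g : A → ℕ} xs → (∀ x → f x ℕ.≤ g x) → sum (map f xs) ℕ.≤ sum (map g xs)
  sum-map-mono []       f≤g = z≤n
  sum-map-mono (x ∷ xs) f≤g = ℕₚ.+-mono-≤ (f≤g x) (sum-map-mono xs f≤g)

  sum-map-+ : ∀ (f g : A → ℕ) xs → sum (map (λ x → f x ℕ.+ g x) xs) ≡ sum (map f xs) ℕ.+ sum (map g xs)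
  sum-map-+ f g []       = refl
  sum-map-+ f g (x ∷ xs) = trans (cong (f x ℕ.+ g x ℕ.+_) (sum-map-+ f g xs))
    (interchange (f x) (g x) (sum (map f xs)) (sum (map g xs)))

  sum-map-indicator : ∀ (p : A → Bool) xs → sum (map (λ x → if p x then 1 else 0) xs) ≡ countB p xs
  sum-map-indicator p []       = refl
  sum-map-indicator p (x ∷ xs) with p x
  ... | true  = cong suc (sum-map-indicator p xs)
  ... | false = sum-map-indicator p xs

countB-allFin-≤ : ∀ {n} (p : Fin n → Bool) → countB p (allFin n) ℕ.≤ n
countB-allFin-≤ {n} p = subst (countB p (allFin n) ℕ.≤_) (length-tabulate {n = n} (λ i → i))
                          (countB-≤-length p (allFin n))

countB-tabulate-none : ∀ {A : Set} {n} {p : A → Bool} (f : Fin n → A) →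
  (∀ i → ¬ T (p (f i))) → countB p (tabulate f) ≡ 0
countB-tabulate-none {n = zero}      f ¬p = refl
countB-tabulate-none {n = suc n} {p} f ¬p with p (f Fin.zero) | ¬p Fin.zero
... | true  | ¬p0 = ⊥-elim (¬p0 _)
... | false | _   = countB-tabulate-none (λ i → f (Fin.suc i)) (λ i → ¬p (Fin.suc i))

countB-tabulate-≤1 : ∀ {A : Set} {n} (p : A → Bool) (f : Fin n → A) →
  (∀ i j → T (p (f i)) → T (p (f j)) → i ≡ j) → countB p (tabulate f) ℕ.≤ 1
countB-tabulate-≤1 {n = zero}  p f unique = z≤n
countB-tabulate-≤1 {n = suc n} p f unique with p (f Fin.zero) in p0
... | true  = ℕₚ.≤-reflexive (cong suc (countB-tabulate-none (λ i → f (Fin.suc i)) none))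
  where
  none : ∀ i → ¬ T (p (f (Fin.suc i)))
  none i pi with unique Fin.zero (Fin.suc i) (subst T (sym p0) _) pi
  ... | ()
... | false = countB-tabulate-≤1 p (λ i → f (Fin.suc i))
                (λ i j pi pj → Finₚ.suc-injective (unique (Fin.suc i) (Fin.suc j) pi pj))

testedDeg : ∀ {n} → List (Fin n × Fin n) → Fin n → ℕ
testedDeg ts v = countB (testedᵇ ts v) (allFin _)

countB-==-≤1 : ∀ {n} (a : Fin n) → countB (a ==_) (allFin n) ℕ.≤ 1
countB-==-≤1 a = countB-tabulate-≤1 (a ==_) (λ i → i)
  (λ i j a≡i a≡j → trans (sym (toWitness a≡i)) (toWitness a≡j))

edgeDeg≤ : ∀ {n} (a b v : Fin n) →
  countB (λ w → (a == v ∧ b == w) ∨ (a == w ∧ b == v)) (allFin n)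
    ℕ.≤ (if a == v then 1 else 0) ℕ.+ (if b == v then 1 else 0)
edgeDeg≤ {n} a b v = ℕₚ.≤-trans (countB-∨ _ _ (allFin n)) (ℕₚ.+-mono-≤ from-a from-b)
  where
  from-a : countB (λ w → a == v ∧ b == w) (allFin n) ℕ.≤ (if a == v then 1 else 0)
  from-a with a == v
  ... | true  = countB-==-≤1 b
  ... | false = ℕₚ.≤-reflexive (countB-tabulate-none {p = λ w → false ∧ b == w} (λ i → i) (λ _ ()))
  from-b : countB (λ w → a == w ∧ b == v) (allFin n) ℕ.≤ (if b == v then 1 else 0)
  from-b with b == v
  ... | true  = ℕₚ.≤-trans (countB-mono (allFin n) (λ w → subst T (Boolₚ.∧-identityʳ (a == w))))
                            (countB-==-≤1 a)
  ... | false = ℕₚ.≤-reflexive (countB-tabulate-none (λ i → i)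
                  (λ w → subst (λ x → ¬ T x) (sym (Boolₚ.∧-zeroʳ (a == w))) λ ()))

sum-testedDeg≤ : ∀ {n} (ts : List (Fin n × Fin n)) → sum (map (testedDeg ts) (allFin n)) ℕ.≤ 2 ℕ.* length ts
sum-testedDeg≤ {n} [] = ℕₚ.≤-reflexive (sum-map-zero (allFin n))
  where
  sum-map-zero : ∀ vs → sum (map (testedDeg []) vs) ≡ 0
  sum-map-zero []       = refl
  sum-map-zero (v ∷ vs) = cong₂ ℕ._+_ (countB-tabulate-none {p = testedᵇ [] v} (λ i → i) (λ _ ())) (sum-map-zero vs)
sum-testedDeg≤ {n} ((a , b) ∷ ts) = begin
  sum (map (testedDeg ((a , b) ∷ ts)) (allFin n))
    ≤⟨ sum-map-mono (allFin n) (λ v → countB-∨ _ (testedᵇ ts v) (allFin n)) ⟩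
  sum (map (λ v → edgeDeg v ℕ.+ testedDeg ts v) (allFin n))
    ≡⟨ sum-map-+ edgeDeg (testedDeg ts) (allFin n) ⟩
  sum (map edgeDeg (allFin n)) ℕ.+ sum (map (testedDeg ts) (allFin n))
    ≤⟨ ℕₚ.+-mono-≤ sum-edgeDeg≤2 (sum-testedDeg≤ ts) ⟩
  2 ℕ.+ 2 ℕ.* length ts
    ≡⟨ ℕₚ.*-suc 2 (length ts) ⟨
  2 ℕ.* suc (length ts) ∎
  where
  open ℕₚ.≤-Reasoning
  edgeDeg : Fin n → ℕ
  edgeDeg v = countB (λ w → (a == v ∧ b == w) ∨ (a == w ∧ b == v)) (allFin n)
  sum-edgeDeg≤2 : sum (map edgeDeg (allFin n)) ℕ.≤ 2
  sum-edgeDeg≤2 = begin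
    sum (map edgeDeg (allFin n))
      ≤⟨ sum-map-mono (allFin n) (edgeDeg≤ a b) ⟩
    sum (map (λ v → (if a == v then 1 else 0) ℕ.+ (if b == v then 1 else 0)) (allFin n))
      ≡⟨ sum-map-+ _ _ (allFin n) ⟩
    sum (map (λ v → if a == v then 1 else 0) (allFin n)) ℕ.+ sum (map (λ v → if b == v then 1 else 0) (allFin n))
      ≡⟨ cong₂ ℕ._+_ (sum-map-indicator (a ==_) (allFin n)) (sum-map-indicator (b ==_) (allFin n)) ⟩
    countB (a ==_) (allFin n) ℕ.+ countB (b ==_) (allFin n)
      ≤⟨ ℕₚ.+-mono-≤ (countB-==-≤1 a) (countB-==-≤1 b) ⟩
    2 ∎

deg≤degU+testedDeg : ∀ {n} (G : Graph n) ts v → deg G v ℕ.≤ degU G ts v ℕ.+ testedDeg ts v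
deg≤degU+testedDeg {n} G ts v =
  ℕₚ.≤-trans (countB-mono (allFin n) untested-or-tested) (countB-∨ _ _ (allFin n))
  where
  untested-or-tested : ∀ w → T (adj G v w) → T ((adj G v w ∧ not (testedᵇ ts v w)) ∨ testedᵇ ts v w)
  untested-or-tested w adj-vw with adj G v w | testedᵇ ts v w
  ... | true | true  = _
  ... | true | false = _

deficiency≤testedDeg : ∀ {n k} (G : Graph n) ts → MinDeg≥ G k → ∀ v → k ℕ.∸ degU G ts v ℕ.≤ testedDeg ts v
deficiency≤testedDeg {k = k} G ts δ≥k v =
  ℕₚ.m≤n+o⇒m∸n≤o k (degU G ts v) (ℕₚ.≤-trans (δ≥k v) (deg≤degU+testedDeg G ts v))

-- The least t ≤ b with Q t, and b if there is none.
least : ∀ {Q : ℕ → Set} → (∀ t → Dec (Q t)) → ℕ → ℕ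
least Q? zero    = 0
least Q? (suc b) with Q? 0
... | yes _ = 0
... | no  _ = suc (least (λ t → Q? (suc t)) b)

least-≤ : ∀ {Q : ℕ → Set} (Q? : ∀ t → Dec (Q t)) b → least Q? b ℕ.≤ b
least-≤ Q? zero    = z≤n
least-≤ Q? (suc b) with Q? 0
... | yes _ = z≤n
... | no  _ = s≤s (least-≤ (λ t → Q? (suc t)) b)

least-minimal : ∀ {Q : ℕ → Set} (Q? : ∀ t → Dec (Q t)) b {t} → Q t → least Q? b ℕ.≤ t
least-minimal Q? zero    Qt = z≤n
least-minimal Q? (suc b) {t} Qt with Q? 0 | t
... | yes _ | _     = z≤n
... | no ¬Q0 | zero  = ⊥-elim (¬Q0 Qt)
... | no _  | suc t = s≤s (least-minimal (λ t → Q? (suc t)) b Qt)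

least-satisfies : ∀ {Q : ℕ → Set} (Q? : ∀ t → Dec (Q t)) b {t} → Q t → t ℕ.≤ b → Q (least Q? b)
least-satisfies Q? zero    Qt z≤n = Qt
least-satisfies Q? (suc b) {t} Qt t≤b with Q? 0 | t | t≤b
... | yes Q0 | _     | _         = Q0
... | no ¬Q0 | zero  | _         = ⊥-elim (¬Q0 Qt)
... | no _   | suc t | s≤s t≤b′ = least-satisfies (λ t → Q? (suc t)) b Qt t≤b′

-- The DFS-algorithm

pick-satisfies : ∀ {n} (ok : Fin n → Bool) pref {w} → pick ok pref ≡ just w → T (ok w)
pick-satisfies ok pref {w} picked with ok pref in ok-pref
pick-satisfies ok pref refl | true  = subst T (sym ok-pref) _
... | false = first-satisfies (allFin _) picked
  where
  first-satisfies : ∀ xs → firstB ok xs ≡ just w → T (ok w)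
  first-satisfies (x ∷ xs) found with ok x in ok-x
  first-satisfies (x ∷ xs) refl | true  = subst T (sym ok-x) _
  ...                           | false = first-satisfies xs found

explored : ∀ {n} → State n → ℕ
explored st = countB (λ v → not (inU st v)) (allFin _)

explored-mono : ∀ {n} (st st′ : State n) → (∀ u → T (inU st′ u) → T (inU st u)) →
                explored st ℕ.≤ explored st′
explored-mono st st′ U′⊆U = countB-mono (allFin _) (λ u → T-not-contra (U′⊆U u))

explored-mono-< : ∀ {n} (st st′ : State n) → (∀ u → T (inU st′ u) → T (inU st u)) →
                  ∀ w → T (inU st w) → ¬ T (inU st′ w) → explored st ℕ.< explored st′
explored-mono-< st st′ U′⊆U w w∈U w∉U′ =
  countB-mono-< (allFin _) (λ u → T-not-contra (U′⊆U u)) (∈-allFin w) (λ w∉U → T-not⁻ w∉U w∈U) (T-not w∉U′)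

-- Query t reads coin t and history lists the answers latest first, so the positive
-- answers so far are the true coins among the first length (history st).
record DFSInvariant {n m} (ω : Vec Bool m) (st : State n) : Set where
  field
    successes≤explored  : countB (λ b → b) (history st) ℕ.≤ explored st
    length-tested       : length (tested st) ≡ length (history st)
    successes≡trueCount : countB (λ b → b) (history st) ≡ trueCount (length (history st)) ω

module _ {n m} {ω : Vec Bool m} {st : State n} (I : DFSInvariant ω st) where
  open DFSInvariant I

  private
    L : ℕ
    L = length (history st)

  DFSInvariant-move : ∀ s d → (∀ u → T (inU (record st { stack = s ; done = d }) u) → T (inU st u)) →
                      DFSInvariant ω (record st { stack = s ; done = d })
  DFSInvariant-move s d U′⊆U = record
    { successes≤explored  = ℕₚ.≤-trans successes≤explored (explored-mono st (record st { stack = s ; done = d }) U′⊆U)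
    ; length-tested       = length-tested
    ; successes≡trueCount = successes≡trueCount
    }

  DFSInvariant-query : ∀ {v rest} w → stack st ≡ v ∷ rest → T (inU st w) →
    let b = coinAt ω (length (history st)) in
    DFSInvariant ω (record st { tested = (v , w) ∷ tested st ; history = b ∷ history st
                              ; stack = if b then w ∷ v ∷ rest else v ∷ rest })
  DFSInvariant-query {v} {rest} w stack≡ w∈U with coinAt ω (length (history st)) in coin
  ... | true = record
    { successes≤explored  = ℕₚ.≤-trans (s≤s successes≤explored) (explored-mono-< st st′ U′⊆U w w∈U w∉U′)
    ; length-tested       = cong suc length-tested
    ; successes≡trueCount = trans (cong suc successes≡trueCount)
        (sym (trans (trueCount-suc L ω) (cong (λ c → if c then suc (trueCount L ω) else trueCount L ω) coin)))
    }
    where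
    st′ : State n
    st′ = record st { stack = w ∷ v ∷ rest }
    U′⊆U : ∀ u → T (inU st′ u) → T (inU st u)
    U′⊆U u u∈U′ rewrite stack≡ with u == w | u == v | u ∈ᵇ rest | u ∈ᵇ done st
    ... | false | false | false | false = _
    w∉U′ : ¬ T (inU st′ w)
    w∉U′ with w == w | fromWitness {a? = w Finₚ.≟ w} refl
    ... | true | _ = λ ()
  ... | false = record
    { successes≤explored  = ℕₚ.≤-trans successes≤explored (explored-mono st (record st { stack = v ∷ rest }) U′⊆U)
    ; length-tested       = cong suc length-tested
    ; successes≡trueCount = trans successes≡trueCount
        (sym (trans (trueCount-suc L ω) (cong (λ c → if c then suc (trueCount L ω) else trueCount L ω) coin)))
    }
    where
    U′⊆U : ∀ u → T (inU (record st { stack = v ∷ rest }) u) → T (inU st u)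
    U′⊆U u rewrite stack≡ = λ u∈U → u∈U

step-preserves : ∀ {n m} (G : Graph n) (ω : Vec Bool m) σ (st : State n) →
                 DFSInvariant ω st → DFSInvariant ω (step G ω σ st)
step-preserves {n} G ω σ st I with stack st in stack≡
... | [] with pick (inU st) (chooseRoot σ st)
...   | nothing = I
...   | just r  = DFSInvariant-move I (r ∷ []) (done st) U′⊆U
  where
  U′⊆U : ∀ u → T (inU (record st { stack = r ∷ [] }) u) → T (inU st u)
  U′⊆U u u∈U′ rewrite stack≡ with u == r | u ∈ᵇ done st
  ... | false | false = _
step-preserves {n} G ω σ st I | v ∷ rest
  with pick (λ w → adj G v w ∧ inU st w ∧ not (testedᵇ (tested st) v w)) (chooseNbr σ st) in picked
...   | nothing = DFSInvariant-move I rest (v ∷ done st) U′⊆U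
  where
  U′⊆U : ∀ u → T (inU (record st { stack = rest ; done = v ∷ done st }) u) → T (inU st u)
  U′⊆U u u∈U′ rewrite stack≡ with u ∈ᵇ rest | u == v | u ∈ᵇ done st
  ... | false | false | false = _
...   | just w  = DFSInvariant-query I w stack≡ w∈U
  where
  w∈U : T (inU st w)
  w∈U = proj₁ (Equivalence.to (Boolₚ.T-∧ {inU st w})
          (proj₂ (Equivalence.to (Boolₚ.T-∧ {adj G v w}) (pick-satisfies _ _ picked))))

runDFS-invariant : ∀ {n m} (G : Graph n) (ω : Vec Bool m) σ → DFSInvariant ω (runDFS G ω σ)
runDFS-invariant {n} G ω σ = iterate-preserves (n ℕ.+ n ℕ.+ n ℕ.* n) initState
  (record { successes≤explored = z≤n ; length-tested = refl ; successes≡trueCount = refl })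
  where
  iterate-preserves : ∀ t st → DFSInvariant ω st → DFSInvariant ω (iterate t (step G ω σ) st)
  iterate-preserves zero    st I = I
  iterate-preserves (suc t) st I = iterate-preserves t (step G ω σ st) (step-preserves G ω σ st I)

runDFS-trueCount≤n : ∀ {n m} (G : Graph n) (ω : Vec Bool m) σ →
  trueCount (length (tested (runDFS G ω σ))) ω ℕ.≤ n
runDFS-trueCount≤n {n} G ω σ = begin
  trueCount (length (tested st)) ω    ≡⟨ cong (λ L → trueCount L ω) length-tested ⟩
  trueCount (length (history st)) ω   ≡⟨ successes≡trueCount ⟨
  countB (λ b → b) (history st)       ≤⟨ successes≤explored ⟩
  explored st                         ≤⟨ countB-allFin-≤ _ ⟩
  n                                   ∎
  where
  open ℕₚ.≤-Reasoning
  st : State n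
  st = runDFS G ω σ
  open DFSInvariant (runDFS-invariant G ω σ)

module FailureAnalysis {n k : ℕ} {c : ℚ} (0≤c : 0ℚ ≤ c) (G : Graph n) (δ≥k : MinDeg≥ G k) where

  -- c t⁵ > k⁵ says t > ε k; a vertex is not free iff its deficiency k ∸ degU satisfies this.
  AboveThreshold : ℕ → Set
  AboveThreshold t = ℕ→ℚ (k ℕ.^ 5) < c * ℕ→ℚ (t ℕ.^ 5)

  aboveThreshold? : ∀ t → Dec (AboveThreshold t)
  aboveThreshold? t = ℕ→ℚ (k ℕ.^ 5) ℚₚ.<? c * ℕ→ℚ (t ℕ.^ 5)

  threshold : ℕ
  threshold = least aboveThreshold? n

  module _ (ts : List (Fin n × Fin n)) where

    nonFree⇒threshold≤testedDeg : ∀ v → T (not (freeᵇ c k G ts v)) → threshold ℕ.≤ testedDeg ts v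
    nonFree⇒threshold≤testedDeg v nonFree =
      ℕₚ.≤-trans (least-minimal aboveThreshold? n (T-not-≤ᵇ nonFree)) (deficiency≤testedDeg G ts δ≥k v)

    nonFreeCount*threshold≤2*tests : nonFreeCount c k G ts ℕ.* threshold ℕ.≤ 2 ℕ.* length ts
    nonFreeCount*threshold≤2*tests =
      ℕₚ.≤-trans (countB-*-≤-sum (allFin n) nonFree⇒threshold≤testedDeg) (sum-testedDeg≤ ts)

    fail⇒4nk<c*nonFreeCount*threshold : T (failᵇ c k G ts) →
      k ℕ.≤ n × ℕ→ℚ 4 * ℕ→ℚ n * ℕ→ℚ k < c * ℕ→ℚ (nonFreeCount c k G ts ℕ.* threshold)
    fail⇒4nk<c*nonFreeCount*threshold fails = k≤n , (begin-strict
      ℕ→ℚ 4 * ℕ→ℚ n * ℕ→ℚ k         <⟨ fifthRoot-*-< 0≤c (*-nonNeg (ℕ→ℚ-nonNeg 4) (ℕ→ℚ-nonNeg n)) (ℕ→ℚ-nonNeg F)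
                                        (ℕ→ℚ-nonNeg k) (ℕ→ℚ-nonNeg threshold) [4n]⁵<c⁴F⁵ k⁵<c*threshold⁵ ⟩
      c * (ℕ→ℚ F * ℕ→ℚ threshold)   ≡⟨ cong (c *_) (ℕ→ℚ-* F threshold) ⟨
      c * ℕ→ℚ (F ℕ.* threshold)     ∎)
      where
      open ℚₚ.≤-Reasoning
      F : ℕ
      F = nonFreeCount c k G ts
      1024n⁵<c⁴F⁵ : ℕ→ℚ (1024 ℕ.* n ℕ.^ 5) < c * c * c * c * ℕ→ℚ (F ℕ.^ 5)
      1024n⁵<c⁴F⁵ = T-not-≤ᵇ fails
      [4n]⁵<c⁴F⁵ : (ℕ→ℚ 4 * ℕ→ℚ n) ^ 5 < c * c * c * c * ℕ→ℚ F ^ 5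
      [4n]⁵<c⁴F⁵ = subst₂ (λ l r → l < c * c * c * c * r)
        (trans (ℕ→ℚ-* (4 ℕ.^ 5) (n ℕ.^ 5))
               (trans (cong₂ _*_ (ℕ→ℚ-^ 4 5) (ℕ→ℚ-^ n 5)) (sym (*-^ (ℕ→ℚ 4) (ℕ→ℚ n) 5))))
        (ℕ→ℚ-^ F 5) 1024n⁵<c⁴F⁵
      0<F : 0 ℕ.< F
      0<F = ℕₚ.n≢0⇒n>0 λ F≡0 → ℚₚ.<-irrefl refl (ℚₚ.≤-<-trans (ℕ→ℚ-nonNeg (1024 ℕ.* n ℕ.^ 5))
        (subst (ℕ→ℚ (1024 ℕ.* n ℕ.^ 5) <_) (trans (cong (λ f → c * c * c * c * ℕ→ℚ (f ℕ.^ 5)) F≡0)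
          (ℚₚ.*-zeroʳ (c * c * c * c))) 1024n⁵<c⁴F⁵))
      nonFree : Σ (Fin n) λ v → T (not (freeᵇ c k G ts v))
      nonFree = countB-witness (allFin n) 0<F
      k≤n : k ℕ.≤ n
      k≤n = ℕₚ.≤-trans (δ≥k (proj₁ nonFree)) (countB-allFin-≤ _)
      k⁵<c*threshold⁵ : ℕ→ℚ k ^ 5 < c * ℕ→ℚ threshold ^ 5
      k⁵<c*threshold⁵ = subst₂ (λ l r → l < c * r) (ℕ→ℚ-^ k 5) (ℕ→ℚ-^ threshold 5)
        (least-satisfies aboveThreshold? n (T-not-≤ᵇ (proj₂ nonFree))
          (ℕₚ.≤-trans (deficiency≤testedDeg G ts δ≥k (proj₁ nonFree)) (countB-allFin-≤ _)))

  -- c t > 2 n k, i.e. t p > 2 n for p = c / k.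
  ManyQueries : ℕ → Set
  ManyQueries t = (ℕ→ℚ n + ℕ→ℚ n) * ℕ→ℚ k < c * ℕ→ℚ t

  manyQueries? : ∀ t → Dec (ManyQueries t)
  manyQueries? t = (ℕ→ℚ n + ℕ→ℚ n) * ℕ→ℚ k ℚₚ.<? c * ℕ→ℚ t

  firstManyQueries : ℕ
  firstManyQueries = least manyQueries? (n ℕ.* n)

  fail⇒manyQueries : ∀ ts → T (failᵇ c k G ts) →
    k ℕ.≤ n × ManyQueries firstManyQueries × firstManyQueries ℕ.≤ length ts
  fail⇒manyQueries ts fails =
      k≤n
    , least-satisfies manyQueries? (n ℕ.* n) {s} (ℚₚ.≤-<-trans X≤X+X X+X<cs)
        (ℕₚ.*-mono-≤ (countB-allFin-≤ (λ v → not (freeᵇ c k G ts v))) (least-≤ aboveThreshold? n))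
    , least-minimal manyQueries? (n ℕ.* n) (halve-< (ℚₚ.<-≤-trans X+X<cs cs≤2cL))
    where
    open ℚₚ.≤-Reasoning
    s : ℕ
    s = nonFreeCount c k G ts ℕ.* threshold
    X : ℚ
    X = (ℕ→ℚ n + ℕ→ℚ n) * ℕ→ℚ k
    k≤n : k ℕ.≤ n
    k≤n = proj₁ (fail⇒4nk<c*nonFreeCount*threshold ts fails)
    X+X<cs : X + X < c * ℕ→ℚ s
    X+X<cs = subst (_< c * ℕ→ℚ s)
      (solve 2 (λ n k → con (ℕ→ℚ 4) :* n :* k := (n :+ n) :* k :+ (n :+ n) :* k) refl (ℕ→ℚ n) (ℕ→ℚ k))
      (proj₂ (fail⇒4nk<c*nonFreeCount*threshold ts fails))
    X≤X+X : X ≤ X + X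
    X≤X+X = subst (_≤ X + X) (ℚₚ.+-identityʳ X)
      (ℚₚ.+-monoʳ-≤ X (*-nonNeg (ℚₚ.+-mono-≤ (ℕ→ℚ-nonNeg n) (ℕ→ℚ-nonNeg n)) (ℕ→ℚ-nonNeg k)))
    cs≤2cL : c * ℕ→ℚ s ≤ c * ℕ→ℚ (length ts) + c * ℕ→ℚ (length ts)
    cs≤2cL = begin
      c * ℕ→ℚ s                                    ≤⟨ *-monoˡ-≤ 0≤c (ℕ→ℚ-mono-≤ (nonFreeCount*threshold≤2*tests ts)) ⟩
      c * ℕ→ℚ (2 ℕ.* length ts)                    ≡⟨ cong (c *_) (ℕ→ℚ-* 2 (length ts)) ⟩
      c * (ℕ→ℚ 2 * ℕ→ℚ (length ts))                ≡⟨ solve 2 (λ c L → c :* (con (ℕ→ℚ 2) :* L) := c :* L :+ c :* L)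
                                                        refl c (ℕ→ℚ (length ts)) ⟩
      c * ℕ→ℚ (length ts) + c * ℕ→ℚ (length ts)    ∎

module _ {n k′ : ℕ} {c δ : ℚ} (G : Graph n) (σ : Strategy n) (0≤c : 0ℚ ≤ c) (c≤k : c ≤ ℕ→ℚ (suc k′))
         (0≤δ : 0ℚ ≤ δ) (2≤δk : 1ℚ + 1ℚ ≤ δ * ℕ→ℚ (suc k′)) (δ≥k : MinDeg≥ G (suc k′)) where

  open FailureAnalysis 0≤c G δ≥k

  private
    0≤p : 0ℚ ≤ c * inv (suc k′)
    0≤p = *-nonNeg 0≤c (inv-nonNeg (suc k′))

    p≤1 : c * inv (suc k′) ≤ 1ℚ
    p≤1 = subst (c * inv (suc k′) ≤_) (trans (ℚₚ.*-comm (ℕ→ℚ (suc k′)) (inv (suc k′))) (inv-*-ℕ→ℚ k′))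
            (*-monoʳ-≤ (inv-nonNeg (suc k′)) c≤k)

    2n<expected : ∀ {t} → ManyQueries t → ℕ→ℚ n + ℕ→ℚ n < ℕ→ℚ t * (c * inv (suc k′))
    2n<expected {t} many = subst₂ _<_
      (trans (ℚₚ.*-assoc (ℕ→ℚ n + ℕ→ℚ n) (ℕ→ℚ (suc k′)) (inv (suc k′)))
        (trans (cong ((ℕ→ℚ n + ℕ→ℚ n) *_) (trans (ℚₚ.*-comm (ℕ→ℚ (suc k′)) (inv (suc k′))) (inv-*-ℕ→ℚ k′)))
          (ℚₚ.*-identityʳ (ℕ→ℚ n + ℕ→ℚ n))))
      (solve 3 (λ c t i → c :* t :* i := t :* (c :* i)) refl c (ℕ→ℚ t) (inv (suc k′)))
      (ℚₚ.*-monoˡ-<-pos (inv (suc k′)) {{positive (inv-pos k′)}} many)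

    t₀ : ℕ
    t₀ = firstManyQueries

    fail⇒viable : ∀ (ω : Vec Bool (n ℕ.* n)) → T (failᵇ c (suc k′) G (tested (runDFS G ω σ))) → suc k′ ℕ.≤ n × ManyQueries t₀
    fail⇒viable ω fail = let k≤n , many , _ = fail⇒manyQueries (tested (runDFS G ω σ)) fail in k≤n , many

    fail⇒fewSuccesses : ∀ (ω : Vec Bool (n ℕ.* n)) → T (failᵇ c (suc k′) G (tested (runDFS G ω σ))) → T (trueCount t₀ ω ℕ.≤ᵇ n)
    fail⇒fewSuccesses ω fail = let _ , _ , t₀≤L = fail⇒manyQueries (tested (runDFS G ω σ)) fail in
      ℕₚ.≤⇒≤ᵇ (ℕₚ.≤-trans (trueCount-mono ω t₀≤L) (runDFS-trueCount≤n G ω σ))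

  failProb≤ : failProb c (suc k′) G σ ≤ δ
  failProb≤ = bound (suc k′ ℕ.≤? n ×-dec manyQueries? t₀)
    where
    open ℚₚ.≤-Reasoning
    bound : Dec (suc k′ ℕ.≤ n × ManyQueries t₀) → failProb c (suc k′) G σ ≤ δ
    bound (yes (k≤n , many)) = begin
      failProb c (suc k′) G σ
        ≤⟨ Pr-mono (n ℕ.* n) {c * inv (suc k′)} (λ ω → failᵇ c (suc k′) G (tested (runDFS G ω σ)))
             (λ ω → trueCount t₀ ω ℕ.≤ᵇ n) 0≤p p≤1 fail⇒fewSuccesses ⟩
      Pr (n ℕ.* n) (c * inv (suc k′)) (λ ω → trueCount t₀ ω ℕ.≤ᵇ n)
        ≤⟨ Pr[trueCount≤]≤ (n ℕ.* n) t₀ n 0≤p p≤1 (least-≤ manyQueries? (n ℕ.* n)) 0≤δ (2n<expected {t₀} many)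
             (ℚₚ.≤-trans 2≤δk (*-monoˡ-≤ 0≤δ (ℕ→ℚ-mono-≤ k≤n))) ⟩
      δ ∎
    bound (no ¬viable) = begin
      failProb c (suc k′) G σ
        ≡⟨ Pr-≡0 (n ℕ.* n) (c * inv (suc k′)) (λ ω → failᵇ c (suc k′) G (tested (runDFS G ω σ)))
             (λ ω fail → ¬viable (fail⇒viable ω fail)) ⟩
      0ℚ ≤⟨ 0≤δ ⟩
      δ ∎

lemma8 : Σ ℚ λ c₀ → ∀ (c : ℚ) → c₀ ≤ c →
           ∀ (δ : ℚ) → 0ℚ < δ →
           Σ ℕ λ K → ∀ (k : ℕ) → K Data.Nat.≤ k →
             ∀ (n : ℕ) (G : Graph n) → MinDeg≥ G k →
             ∀ (σ : Strategy n) → failProb c k G σ ≤ δ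
lemma8 = 0ℚ , λ c 0≤c δ 0<δ →
  let instance
        δ≢0 : NonZero δ
        δ≢0 = >-nonZero 0<δ
      N₁ , c≤N₁ = ℕ→ℚ-unbounded c
      N₂ , 2/δ≤N₂ = ℕ→ℚ-unbounded ((1ℚ + 1ℚ) * 1/ δ)
  in suc (N₁ ℕ.+ N₂) , λ where
    (suc k′) (s≤s N₁+N₂≤k′) n G δ≥k σ →
      let N₁≤k = ℕₚ.m≤n⇒m≤1+n (ℕₚ.m+n≤o⇒m≤o N₁ N₁+N₂≤k′)
          N₂≤k = ℕₚ.m≤n⇒m≤1+n (ℕₚ.m+n≤o⇒n≤o N₁ N₁+N₂≤k′)
      in failProb≤ G σ 0≤c (ℚₚ.≤-trans c≤N₁ (ℕ→ℚ-mono-≤ N₁≤k)) (ℚₚ.<⇒≤ 0<δ)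
           (2/δ≤N⇒2≤δN {N = suc k′} (ℚₚ.<⇒≤ 0<δ) (ℚₚ.≤-trans 2/δ≤N₂ (ℕ→ℚ-mono-≤ N₂≤k))) δ≥k
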